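{- Let $n\geq 1$. For $j=1$, \[|\{\pi\in\mathrm{PPF}_{n+1}:\pi_1=j\}|=|\mathrm{PF}_{n}|=(n+1)^{n-1}.\] For $j=2,3,\ldots, n$, \[|\{\pi\in\mathrm{PPF}_{n+1}:\pi_1=j\}|=\sum_{k=1}^{n-1}\frac{n}{k+1}f_{n}(j,k).\]
   Context: A (classical) parking function of length $n$ is a sequence $\pi=(\pi_1,\dots,\pi_n)$ of positive integers whose increasing rearrangement $\lambda$ satisfies $\lambda_i\le i$; $\mathrm{PF}_n$ denotes the set of such. A parking function of length $n+1$ is prime if removing any instance of 1 yields a parking function of length $n$; $\mathrm{PPF}_{n+1}$ denotes this set. For a tuple $\alpha$, $N_1(\alpha)$ is the number of ones in $\alpha$, and $f_n(j,k)=|\{\pi\in\mathrm{PF}_n:\pi_1=j,\ N_1(\pi)=k\}|$. -}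

module Defs where

open import Data.Nat using (ℕ; zero; suc; _+_; _≤ᵇ_; _≡ᵇ_)
open import Data.Nat.Properties using (≤-decTotalOrder)
open import Data.Bool using (Bool; true; false; _∧_; if_then_else_)
open import Data.List using (List; []; _∷_; map; filter; length; upTo; concatMap; _++_; foldr)
open import Data.List.Sort.InsertionSort.Base ≤-decTotalOrder using (sort)
open import Data.Integer using (+_)
import Data.Rational as ℚ
open ℚ using (ℚ; 0ℚ)
open import Relation.Nullary.Decidable using (does)
open import Relation.Unary using (Pred)

-- Sequences are lists of natural numbers; entry i (1-indexed) is π_i.

okFrom : ℕ → List ℕ → Bool
okFrom i []       = true
okFrom i (x ∷ xs) = (1 ≤ᵇ x) ∧ (x ≤ᵇ i) ∧ okFrom (suc i) xs

isPF : List ℕ → Bool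
isPF π = okFrom 1 (sort π)

removeOnes : List ℕ → List (List ℕ)
removeOnes []       = []
removeOnes (x ∷ xs) = (if x ≡ᵇ 1 then xs ∷ [] else []) ++ map (x ∷_) (removeOnes xs)

allB : {A : Set} → (A → Bool) → List A → Bool
allB p []       = true
allB p (x ∷ xs) = p x ∧ allB p xs

isPPF : List ℕ → Bool
isPPF π = isPF π ∧ allB isPF (removeOnes π)

firstIs : ℕ → List ℕ → Bool
firstIs j []      = false
firstIs j (x ∷ _) = x ≡ᵇ j

N₁ : List ℕ → ℕ
N₁ α = length (filter (λ x → x Data.Nat.≟ 1) α)

seqs : ℕ → ℕ → List (List ℕ)
seqs m zero      = [] ∷ []
seqs m (suc len) = concatMap (λ x → map (x ∷_) (seqs m len)) (map suc (upTo m))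

countB : (List ℕ → Bool) → List (List ℕ) → ℕ
countB p xs = length (filter (λ x → Data.Bool._≟_ (p x) true) xs)

-- Every parking function of length n has entries in {1,…,n}, so PF_n is
-- exactly the set of sequences in seqs n n satisfying isPF.
-- |PF_n|
numPF : ℕ → ℕ
numPF n = countB isPF (seqs n n)

numPPFfirst : ℕ → ℕ → ℕ
numPPFfirst n j = countB (λ π → isPPF π ∧ firstIs j π) (seqs (suc n) (suc n))

f : ℕ → ℕ → ℕ → ℕ
f n j k = countB (λ π → isPF π ∧ firstIs j π ∧ (N₁ π ≡ᵇ k)) (seqs n n)

ℕ→ℚ : ℕ → ℚ
ℕ→ℚ m = (+ m) ℚ./ 1

rhsSum : ℕ → ℕ → ℚ
rhsSum n j = foldr ℚ._+_ 0ℚ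
  (map (λ k → ((+ n) ℚ./ suc k) ℚ.* ℕ→ℚ (f n j k)) (map suc (upTo (n Data.Nat.∸ 1))))

{-# OPTIONS --safe #-}
-- Split a sequence π of positive integers into its N₁ π ones and stripOnes π,
-- the remaining entries each lowered by one.  Then
-- sort π = 1^(N₁ π) ++ map suc (sort (stripOnes π)), so π parks from offset
-- a + 1 (λ_i ≤ a + i) iff stripOnes π parks from offset a + N₁ π.  Deleting a
-- single 1 keeps stripOnes π and lowers N₁ by one, and parking from offset
-- N₁ π − 1 implies parking from offset N₁ π; hence π is prime iff stripOnes π
-- parks from offset N₁ π − 1.  Counting sequences by the positions of their
-- ones turns all counts into binomial convolutions.  With Abel's identity this
-- shows by induction that b (b + n)^(n − 1) sequences of length n park from
-- offset b; b = 1 gives |PF_n| = (n + 1)^(n − 1), and 1σ is prime iff σ is a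
-- parking function.  For j ≥ 2, both |{π ∈ PPF_{n+1} : π_1 = j}| and f_n(j,k)
-- reduce to the number A_k of sequences ρ of length n − 1 − k such that
-- (j − 1)ρ parks from offset k, with weights C(n, k + 1) and C(n − 1, k), and
-- n C(n − 1, k) = (k + 1) C(n, k + 1).
module Submission where

open import Algebra.Bundles using (CommutativeMonoid)
open import Data.Bool using (Bool; true; false; if_then_else_; _∧_; _∨_; T)
open import Data.Bool.Properties using (∧-zeroʳ; ∧-identityʳ; ∧-comm; ∧-commutativeMonoid; ∨-zeroʳ; T-∧; T-≡)
open import Data.Empty using (⊥-elim)
import Data.Integer as ℤ
import Data.Integer.Properties as ℤ
open import Data.List using (List; []; _∷_; map; length; upTo; applyUpTo; concatMap; _++_; replicate; foldr)
open import Data.List.Properties using (map-upTo; map-applyUpTo; length-map)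
open import Data.List.Relation.Binary.Permutation.Propositional using (↭-sym)
open import Data.List.Relation.Binary.Permutation.Propositional.Properties using (All-resp-↭; ↭-length)
open import Data.List.Relation.Unary.All as All using (All; []; _∷_; universal)
open import Data.List.Relation.Unary.All.Properties using (++⁺; map⁺; replicate⁺)
open import Data.Nat using (ℕ; zero; suc; _+_; _*_; _∸_; _^_; _≤_; _<_; z≤n; s≤s; _≤ᵇ_; _≡ᵇ_; NonZero)
open import Data.Nat.Combinatorics using (_C_; nCk+nC[k+1]≡[n+1]C[k+1]; nC1≡n; k>n⇒nCk≡0)
open import Data.Nat.Properties
  using ( _≟_; _≤?_; ≤-decTotalOrder; ≤-refl; ≤-trans; ≤-pred; <-irrefl; <⇒≱; ≤ᵇ⇒≤; ≤⇒≤ᵇ; m≤n⇒m≤1+n; m≤n+m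
        ; +-assoc; +-suc; +-identityʳ; *-identityˡ; *-identityʳ; *-zeroʳ; *-assoc; *-comm; *-distribʳ-+; *-distribˡ-+
        ; *-cancelˡ-≡; +-∸-assoc; m+[n∸m]≡n; m∸n+n≡m; *-commutativeSemigroup)
open import Data.Nat.Tactic.RingSolver using (solve-∀)
open import Data.List.Sort.InsertionSort.Base ≤-decTotalOrder using (sort; insert)
open import Data.List.Sort.InsertionSort.Properties ≤-decTotalOrder using (sort-↭)
open import Data.Product using (_×_; _,_)
import Data.Rational as ℚ
import Data.Rational.Properties as ℚ
import Data.Rational.Unnormalised as ℚᵘ
import Data.Rational.Unnormalised.Properties as ℚᵘ
open import Function using (_∘_)
open import Function.Bundles using (Equivalence)
open import Relation.Binary.PropositionalEquality using (_≡_; _≢_; refl; sym; trans; cong; cong₂; subst)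
open import Relation.Nullary using (yes; no)
open import Relation.Nullary.Decidable using (dec-true; dec-false)
open import Algebra.Properties.CommutativeSemigroup *-commutativeSemigroup
  using () renaming (x∙yz≈y∙xz to *-left-comm)
open import Algebra.Properties.CommutativeSemigroup (CommutativeMonoid.commutativeSemigroup ∧-commutativeMonoid)
  using () renaming (x∙yz≈y∙xz to ∧-left-comm)

open import Defs

open Relation.Binary.PropositionalEquality.≡-Reasoning

-- Finite sums

∑< : ℕ → (ℕ → ℕ) → ℕ
∑< zero    g = 0
∑< (suc m) g = g 0 + ∑< m (λ i → g (suc i))

syntax ∑< m (λ i → g) = ∑[ i < m ] g

∑-cong : ∀ m {g h : ℕ → ℕ} → (∀ {i} → i < m → g i ≡ h i) → ∑< m g ≡ ∑< m h
∑-cong zero    eq = refl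
∑-cong (suc m) eq = cong₂ _+_ (eq (s≤s z≤n)) (∑-cong m (λ i<m → eq (s≤s i<m)))

∑-zero : ∀ m {g : ℕ → ℕ} → (∀ {i} → i < m → g i ≡ 0) → ∑< m g ≡ 0
∑-zero zero    eq = refl
∑-zero (suc m) eq rewrite eq (s≤s z≤n) = ∑-zero m (λ i<m → eq (s≤s i<m))

∑-single : ∀ {m} {g : ℕ → ℕ} i₀ → i₀ < m → (∀ {i} → i < m → i ≢ i₀ → g i ≡ 0) → ∑< m g ≡ g i₀
∑-single {suc m} {g} zero     _         eq = trans (cong (g 0 +_) (∑-zero m (λ i<m → eq (s≤s i<m) λ ()))) (+-identityʳ (g 0))
∑-single {suc m}     (suc i₀) (s≤s i₀<m) eq rewrite eq (s≤s z≤n) (λ ()) =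
  ∑-single i₀ i₀<m (λ i<m i≢i₀ → eq (s≤s i<m) (λ { refl → i≢i₀ refl }))

∑-init-last : ∀ m (g : ℕ → ℕ) → ∑[ i < suc m ] g i ≡ ∑< m g + g m
∑-init-last zero    g = +-identityʳ (g 0)
∑-init-last (suc m) g = trans (cong (g 0 +_) (∑-init-last m (λ i → g (suc i)))) (sym (+-assoc (g 0) _ _))

∑-distrib-+ : ∀ m (g h : ℕ → ℕ) → ∑[ i < m ] (g i + h i) ≡ ∑< m g + ∑< m h
∑-distrib-+ zero    g h = refl
∑-distrib-+ (suc m) g h rewrite ∑-distrib-+ m (λ i → g (suc i)) (λ i → h (suc i)) =
  interchange (g 0) (h 0) _ _
  where
  interchange : ∀ a b c d → a + b + (c + d) ≡ a + c + (b + d)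
  interchange = solve-∀

*-distribˡ-∑ : ∀ m c (g : ℕ → ℕ) → c * ∑< m g ≡ ∑[ i < m ] (c * g i)
*-distribˡ-∑ zero    c g = *-zeroʳ c
*-distribˡ-∑ (suc m) c g = trans (*-distribˡ-+ c (g 0) _) (cong (c * g 0 +_) (*-distribˡ-∑ m c (λ i → g (suc i))))

∑-comm : ∀ m n (h : ℕ → ℕ → ℕ) → ∑[ i < m ] ∑[ k < n ] h i k ≡ ∑[ k < n ] ∑[ i < m ] h i k
∑-comm zero    n h = sym (∑-zero n (λ _ → refl))
∑-comm (suc m) n h = begin
  ∑[ k < n ] h 0 k + ∑[ i < m ] ∑[ k < n ] h (suc i) k   ≡⟨ cong (∑[ k < n ] h 0 k +_) (∑-comm m n (λ i → h (suc i))) ⟩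
  ∑[ k < n ] h 0 k + ∑[ k < n ] ∑[ i < m ] h (suc i) k   ≡⟨ ∑-distrib-+ n (h 0) _ ⟨
  ∑[ k < n ] (h 0 k + ∑[ i < m ] h (suc i) k)            ∎

count : {A : Set} → (A → Bool) → List A → ℕ
count p []       = 0
count p (x ∷ xs) = (if p x then 1 else 0) + count p xs

countB≡count : ∀ p xs → countB p xs ≡ count p xs
countB≡count p []       = refl
countB≡count p (x ∷ xs) with p x
... | true  = cong suc (countB≡count p xs)
... | false = countB≡count p xs

module _ {A : Set} where

  count-++ : ∀ (p : A → Bool) xs ys → count p (xs ++ ys) ≡ count p xs + count p ys
  count-++ p []       ys = refl
  count-++ p (x ∷ xs) ys =
    trans (cong (px +_) (count-++ p xs ys)) (sym (+-assoc px (count p xs) (count p ys)))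
    where px = if p x then 1 else 0

  count-map : ∀ {B : Set} (p : A → Bool) (f : B → A) xs → count p (map f xs) ≡ count (λ x → p (f x)) xs
  count-map p f []       = refl
  count-map p f (x ∷ xs) = cong (_ +_) (count-map p f xs)

  count-zero : ∀ {p : A → Bool} xs → (∀ x → p x ≡ false) → count p xs ≡ 0
  count-zero []       _      = refl
  count-zero (x ∷ xs) p≡false rewrite p≡false x = count-zero xs p≡false

  count-cong : ∀ {p q : A → Bool} xs → (∀ x → p x ≡ q x) → count p xs ≡ count q xs
  count-cong []       _    = refl
  count-cong (x ∷ xs) p≡q = cong₂ _+_ (cong (λ b → if b then 1 else 0) (p≡q x)) (count-cong xs p≡q)

  count-concatMap-applyUpTo : ∀ {B : Set} (p : A → Bool) (h : B → List A) (f : ℕ → B) m →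
    count p (concatMap h (applyUpTo f m)) ≡ ∑[ i < m ] count p (h (f i))
  count-concatMap-applyUpTo p h f zero    = refl
  count-concatMap-applyUpTo p h f (suc m) =
    trans (count-++ p (h (f 0)) _) (cong (_ +_) (count-concatMap-applyUpTo p h (λ i → f (suc i)) m))

count-seqs-suc : ∀ (p : List ℕ → Bool) m l → count p (seqs m (suc l)) ≡ ∑[ w < m ] count (λ σ → p (suc w ∷ σ)) (seqs m l)
count-seqs-suc p m l = begin
  count p (concatMap (λ x → map (x ∷_) (seqs m l)) (map suc (upTo m)))
    ≡⟨ cong (λ xs → count p (concatMap (λ x → map (x ∷_) (seqs m l)) xs)) (map-upTo suc m) ⟩
  count p (concatMap (λ x → map (x ∷_) (seqs m l)) (applyUpTo suc m))
    ≡⟨ count-concatMap-applyUpTo p _ suc m ⟩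
  ∑[ w < m ] count p (map (suc w ∷_) (seqs m l))
    ≡⟨ ∑-cong m (λ {w} _ → count-map p (suc w ∷_) (seqs m l)) ⟩
  ∑[ w < m ] count (λ σ → p (suc w ∷ σ)) (seqs m l) ∎

count-cong-seqs : ∀ m l {p q} → (∀ {π} → length π ≡ l → All (1 ≤_) π → p π ≡ q π) →
  count p (seqs m l) ≡ count q (seqs m l)
count-cong-seqs m zero    eq = cong (λ b → (if b then 1 else 0) + 0) (eq refl [])
count-cong-seqs m (suc l) {p} {q} eq = begin
  count p (seqs m (suc l))                          ≡⟨ count-seqs-suc p m l ⟩
  ∑[ w < m ] count (λ σ → p (suc w ∷ σ)) (seqs m l) ≡⟨ ∑-cong m (λ _ → count-cong-seqs m l (λ len pos → eq (cong suc len) (s≤s z≤n ∷ pos))) ⟩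
  ∑[ w < m ] count (λ σ → q (suc w ∷ σ)) (seqs m l) ≡⟨ count-seqs-suc q m l ⟨
  count q (seqs m (suc l))                          ∎

count-seqs-shrink : ∀ m l (p : List ℕ → Bool) → (∀ {π} → length π ≡ l → T (p π) → All (_≤ m) π) →
  count p (seqs (suc m) l) ≡ count p (seqs m l)
count-seqs-shrink m zero    p bounded = refl
count-seqs-shrink m (suc l) p bounded = begin
  count p (seqs (suc m) (suc l))
    ≡⟨ count-seqs-suc p (suc m) l ⟩
  ∑[ w < suc m ] count (λ σ → p (suc w ∷ σ)) (seqs (suc m) l)
    ≡⟨ ∑-init-last m _ ⟩
  ∑[ w < m ] count (λ σ → p (suc w ∷ σ)) (seqs (suc m) l) + count (λ σ → p (suc m ∷ σ)) (seqs (suc m) l)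
    ≡⟨ cong₂ _+_ (∑-cong m (λ {w} _ → count-seqs-shrink m l (λ σ → p (suc w ∷ σ)) (tail-bounded w)))
                 (trans (count-cong-seqs (suc m) l (λ len _ → top-excluded len)) (count-zero (seqs (suc m) l) (λ _ → refl))) ⟩
  ∑[ w < m ] count (λ σ → p (suc w ∷ σ)) (seqs m l) + 0
    ≡⟨ +-identityʳ _ ⟩
  ∑[ w < m ] count (λ σ → p (suc w ∷ σ)) (seqs m l)
    ≡⟨ count-seqs-suc p m l ⟨
  count p (seqs m (suc l)) ∎
  where
  tail-bounded : ∀ w {σ} → length σ ≡ l → T (p (suc w ∷ σ)) → All (_≤ m) σ
  tail-bounded w len pσ with bounded (cong suc len) pσ
  ... | _ ∷ σ≤m = σ≤m
  top-excluded : ∀ {σ} → length σ ≡ l → p (suc m ∷ σ) ≡ false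
  top-excluded {σ} len with p (suc m ∷ σ) in pσ
  ... | false = refl
  ... | true with bounded (cong suc len) (Equivalence.from T-≡ pσ)
  ...   | m<m ∷ _ = ⊥-elim (<-irrefl refl m<m)

count-seqs-firstIs : ∀ {m l j} (p : List ℕ → Bool) → 1 ≤ j → j ≤ m →
  count (λ π → firstIs j π ∧ p π) (seqs m (suc l)) ≡ count (λ σ → p (j ∷ σ)) (seqs m l)
count-seqs-firstIs {m} {l} {suc j₀} p _ j≤m = begin
  count (λ π → firstIs (suc j₀) π ∧ p π) (seqs m (suc l))
    ≡⟨ count-seqs-suc (λ π → firstIs (suc j₀) π ∧ p π) m l ⟩
  ∑[ w < m ] count (λ σ → (suc w ≡ᵇ suc j₀) ∧ p (suc w ∷ σ)) (seqs m l)
    ≡⟨ ∑-single j₀ j≤m (λ {w} _ w≢j₀ → count-zero (seqs m l) (λ σ → cong (_∧ p (suc w ∷ σ)) (dec-false (w ≟ j₀) w≢j₀))) ⟩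
  count (λ σ → (suc j₀ ≡ᵇ suc j₀) ∧ p (suc j₀ ∷ σ)) (seqs m l)
    ≡⟨ count-cong (seqs m l) (λ σ → cong (_∧ p (suc j₀ ∷ σ)) (dec-true (j₀ ≟ j₀) refl)) ⟩
  count (λ σ → p (suc j₀ ∷ σ)) (seqs m l) ∎

-- Binomial sums and Abel's identity

[k+1]*[n+1]C[k+1]≡[n+1]*nCk : ∀ n k → suc k * (suc n C suc k) ≡ suc n * (n C k)
[k+1]*[n+1]C[k+1]≡[n+1]*nCk n       zero    = trans (+-identityʳ _) (trans (nC1≡n (suc n)) (sym (*-identityʳ (suc n))))
[k+1]*[n+1]C[k+1]≡[n+1]*nCk zero    (suc k) = *-zeroʳ (suc (suc k))
[k+1]*[n+1]C[k+1]≡[n+1]*nCk (suc n) (suc k) = begin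
  suc (suc k) * (suc (suc n) C suc (suc k))
    ≡⟨ cong (suc (suc k) *_) (nCk+nC[k+1]≡[n+1]C[k+1] (suc n) (suc k)) ⟨
  suc (suc k) * (suc n C suc k + suc n C suc (suc k))
    ≡⟨ split (suc n C suc k) (suc n C suc (suc k)) ⟩
  suc n C suc k + suc k * (suc n C suc k) + suc (suc k) * (suc n C suc (suc k))
    ≡⟨ cong₂ (λ u v → suc n C suc k + u + v) ([k+1]*[n+1]C[k+1]≡[n+1]*nCk n k) ([k+1]*[n+1]C[k+1]≡[n+1]*nCk n (suc k)) ⟩
  suc n C suc k + suc n * (n C k) + suc n * (n C suc k)
    ≡⟨ trans (+-assoc (suc n C suc k) _ _) (cong (suc n C suc k +_) (sym (*-distribˡ-+ (suc n) (n C k) (n C suc k)))) ⟩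
  suc n C suc k + suc n * (n C k + n C suc k)
    ≡⟨ cong (λ z → suc n C suc k + suc n * z) (nCk+nC[k+1]≡[n+1]C[k+1] n k) ⟩
  suc (suc n) * (suc n C suc k) ∎
  where
  split : ∀ x y → suc (suc k) * (x + y) ≡ x + suc k * x + suc (suc k) * y
  split = solve-∀

∑-pascal : ∀ n (G : ℕ → ℕ → ℕ) →
  ∑[ k < suc (suc n) ] ((suc n C k) * G k (suc n ∸ k))
  ≡ ∑[ k < suc n ] ((n C k) * G (suc k) (n ∸ k)) + ∑[ k < suc n ] ((n C k) * G k (suc (n ∸ k)))
∑-pascal n G = begin
  G₀ + ∑[ k < suc n ] ((suc n C suc k) * G (suc k) (n ∸ k))
    ≡⟨ cong (G₀ +_) (∑-cong (suc n) λ {k} _ → trans (sym (*-distribʳ-+ _ (n C k) (n C suc k))) (cong (_* G (suc k) (n ∸ k)) (nCk+nC[k+1]≡[n+1]C[k+1] n k))) ⟨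
  G₀ + ∑[ k < suc n ] ((n C k) * G (suc k) (n ∸ k) + (n C suc k) * G (suc k) (n ∸ k))
    ≡⟨ cong (G₀ +_) (∑-distrib-+ (suc n) (λ k → (n C k) * G (suc k) (n ∸ k)) (λ k → (n C suc k) * G (suc k) (n ∸ k))) ⟩
  G₀ + (S₁ + ∑[ k < suc n ] ((n C suc k) * G (suc k) (n ∸ k)))
    ≡⟨ cong (λ z → G₀ + (S₁ + z)) (∑-init-last n _) ⟩
  G₀ + (S₁ + (∑[ k < n ] ((n C suc k) * G (suc k) (n ∸ k)) + (n C suc n) * G (suc n) (n ∸ n)))
    ≡⟨ cong (λ z → G₀ + (S₁ + z)) (cong₂ _+_ (∑-cong n λ {k} k<n → cong (λ l → (n C suc k) * G (suc k) l) (+-∸-assoc 1 k<n)) (cong (_* G (suc n) (n ∸ n)) (k>n⇒nCk≡0 {n} ≤-refl))) ⟩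
  G₀ + (S₁ + (S₂ + 0))
    ≡⟨ regroup G₀ S₁ S₂ ⟩
  S₁ + (G₀ + S₂) ∎
  where
  G₀ = 1 * G 0 (suc n)
  S₁ = ∑[ k < suc n ] ((n C k) * G (suc k) (n ∸ k))
  S₂ = ∑[ k < n ] ((n C suc k) * G (suc k) (suc (n ∸ suc k)))
  regroup : ∀ a b c → a + (b + (c + 0)) ≡ b + (a + c)
  regroup = solve-∀

∑-binomial-linear : ∀ c n x →
  ∑[ k < suc n ] ((n C k) * ((x + k) * c ^ (n ∸ k))) ≡ x * suc c ^ n + n * suc c ^ (n ∸ 1)
∑-binomial-linear c zero    x = base x
  where
  base : ∀ x → 1 * ((x + 0) * 1) + 0 ≡ x * 1 + 0
  base = solve-∀
∑-binomial-linear c (suc n) x = begin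
  ∑[ k < suc (suc n) ] ((suc n C k) * ((x + k) * c ^ (suc n ∸ k)))
    ≡⟨ ∑-pascal n (λ k l → (x + k) * c ^ l) ⟩
  ∑[ k < suc n ] ((n C k) * ((x + suc k) * c ^ (n ∸ k))) + ∑[ k < suc n ] ((n C k) * ((x + k) * c ^ suc (n ∸ k)))
    ≡⟨ cong₂ _+_ (∑-cong (suc n) λ {k} _ → cong (λ y → (n C k) * (y * c ^ (n ∸ k))) (+-suc x k))
                 (trans (∑-cong (suc n) λ {k} _ → pull-c (n C k) (x + k) (c ^ (n ∸ k))) (sym (*-distribˡ-∑ (suc n) c (λ k → (n C k) * ((x + k) * c ^ (n ∸ k)))))) ⟩
  ∑[ k < suc n ] ((n C k) * ((suc x + k) * c ^ (n ∸ k))) + c * ∑[ k < suc n ] ((n C k) * ((x + k) * c ^ (n ∸ k)))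
    ≡⟨ cong₂ (λ u v → u + c * v) (∑-binomial-linear c n (suc x)) (∑-binomial-linear c n x) ⟩
  suc x * X + Y + c * (x * X + Y)
    ≡⟨ collect x c X Y ⟩
  x * (suc c * X) + X + suc c * Y
    ≡⟨ cong (x * (suc c * X) + X +_) (lower-power n) ⟩
  x * (suc c * X) + X + n * X
    ≡⟨ +-assoc (x * (suc c * X)) X (n * X) ⟩
  x * suc c ^ suc n + suc n * suc c ^ n ∎
  where
  X = suc c ^ n
  Y = n * suc c ^ (n ∸ 1)
  pull-c : ∀ b y z → b * (y * (c * z)) ≡ c * (b * (y * z))
  pull-c b y z = trans (cong (b *_) (*-left-comm y c z)) (*-left-comm b c (y * z))
  collect : ∀ x c X Y → suc x * X + Y + c * (x * X + Y) ≡ x * (suc c * X) + X + suc c * Y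
  collect = solve-∀
  lower-power : ∀ n → suc c * (n * suc c ^ (n ∸ 1)) ≡ n * suc c ^ n
  lower-power zero    = *-zeroʳ (suc c)
  lower-power (suc n) = *-left-comm (suc c) (suc n) (suc c ^ n)

-- b (b + l)^(l − 1): the Pitman–Stanley count of x-parking functions for x = (b, 1, …, 1).
numPFFrom : ℕ → ℕ → ℕ
numPFFrom b zero    = 1
numPFFrom b (suc l) = b * (b + suc l) ^ l

[b+l]*numPFFrom≡b*[b+l]^l : ∀ b l → (b + l) * numPFFrom b l ≡ b * (b + l) ^ l
[b+l]*numPFFrom≡b*[b+l]^l b zero    = trans (*-identityʳ (b + 0)) (trans (+-identityʳ b) (sym (*-identityʳ b)))
[b+l]*numPFFrom≡b*[b+l]^l b (suc l) = *-left-comm (b + suc l) b ((b + suc l) ^ l)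

-- Multiplied by a + n = (a + k) + (n − k), the k-th term becomes C(n,k) (a + k) (a + n)^(n − k).
∑-abel : ∀ a n → ∑[ k < suc n ] ((n C k) * numPFFrom (a + k) (n ∸ k)) ≡ numPFFrom (suc a) n
∑-abel a zero     = refl
∑-abel a n@(suc n₀) = *-cancelˡ-≡ _ _ (a + n) {{a+n≢0}} (begin
  (a + n) * ∑[ k < suc n ] ((n C k) * numPFFrom (a + k) (n ∸ k))
    ≡⟨ *-distribˡ-∑ (suc n) (a + n) (λ k → (n C k) * numPFFrom (a + k) (n ∸ k)) ⟩
  ∑[ k < suc n ] ((a + n) * ((n C k) * numPFFrom (a + k) (n ∸ k)))
    ≡⟨ ∑-cong (suc n) (λ {k} k<1+n → term k (≤-pred k<1+n)) ⟩
  ∑[ k < suc n ] ((n C k) * ((a + k) * (a + n) ^ (n ∸ k)))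
    ≡⟨ ∑-binomial-linear (a + n) n a ⟩
  a * suc (a + n) ^ n + n * suc (a + n) ^ n₀
    ≡⟨ factor a n₀ (suc (a + n) ^ n₀) ⟩
  (a + n) * numPFFrom (suc a) n ∎)
  where
  a+n≢0 : NonZero (a + n)
  a+n≢0 rewrite +-suc a n₀ = _
  factor : ∀ a n₀ z → a * (suc (a + suc n₀) * z) + suc n₀ * z ≡ (a + suc n₀) * (suc a * z)
  factor = solve-∀
  term : ∀ k → k ≤ n → (a + n) * ((n C k) * numPFFrom (a + k) (n ∸ k)) ≡ (n C k) * ((a + k) * (a + n) ^ (n ∸ k))
  term k k≤n = begin
    (a + n) * ((n C k) * numPFFrom (a + k) (n ∸ k))
      ≡⟨ *-left-comm (a + n) (n C k) _ ⟩
    (n C k) * ((a + n) * numPFFrom (a + k) (n ∸ k))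
      ≡⟨ cong (λ c → (n C k) * (c * numPFFrom (a + k) (n ∸ k))) a+n≡ ⟩
    (n C k) * ((a + k + (n ∸ k)) * numPFFrom (a + k) (n ∸ k))
      ≡⟨ cong ((n C k) *_) ([b+l]*numPFFrom≡b*[b+l]^l (a + k) (n ∸ k)) ⟩
    (n C k) * ((a + k) * (a + k + (n ∸ k)) ^ (n ∸ k))
      ≡⟨ cong (λ c → (n C k) * ((a + k) * c ^ (n ∸ k))) a+n≡ ⟨
    (n C k) * ((a + k) * (a + n) ^ (n ∸ k)) ∎
    where
    a+n≡ : a + n ≡ a + k + (n ∸ k)
    a+n≡ = trans (cong (a +_) (sym (m+[n∸m]≡n k≤n))) (sym (+-assoc a k (n ∸ k)))

-- The ones of a sequence

stripOnes : List ℕ → List ℕ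
stripOnes []                 = []
stripOnes (zero ∷ xs)        = zero ∷ stripOnes xs
stripOnes (suc zero ∷ xs)    = stripOnes xs
stripOnes (suc (suc x) ∷ xs) = suc x ∷ stripOnes xs

-- π parks from offset b: its increasing rearrangement satisfies 1 ≤ λ_i ≤ b + i − 1.
isPFFrom : ℕ → List ℕ → Bool
isPFFrom b π = okFrom b (sort π)

insert-least : ∀ {x} L → All (x ≤_) L → insert x L ≡ x ∷ L
insert-least         []       []          = refl
insert-least {x} (y ∷ L) (x≤y ∷ _) rewrite dec-true (x ≤? y) x≤y = refl

insert-++ : ∀ {x} P L → All (_< x) P → insert x (P ++ L) ≡ P ++ insert x L
insert-++         []      L []           = refl
insert-++ {x} (y ∷ P) L (y<x ∷ P<x) rewrite dec-false (x ≤? y) (<⇒≱ y<x) = cong (y ∷_) (insert-++ P L P<x)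

insert-map-suc : ∀ x S → insert (suc x) (map suc S) ≡ map suc (insert x S)
insert-map-suc x []      = refl
insert-map-suc x (y ∷ S) with x ≤? y
... | yes x≤y rewrite dec-true (x ≤? y) x≤y | dec-true (suc x ≤? suc y) (s≤s x≤y) = refl
... | no  x≰y rewrite dec-false (x ≤? y) x≰y | dec-false (suc x ≤? suc y) (x≰y ∘ ≤-pred) = cong (suc y ∷_) (insert-map-suc x S)

sort-stripOnes : ∀ π → All (1 ≤_) π → sort π ≡ replicate (N₁ π) 1 ++ map suc (sort (stripOnes π))
sort-stripOnes []                 []      = refl
sort-stripOnes (suc zero ∷ π)     (_ ∷ π⁺) = begin
  insert 1 (sort π)                                             ≡⟨ cong (insert 1) (sort-stripOnes π π⁺) ⟩
  insert 1 (replicate (N₁ π) 1 ++ map suc (sort (stripOnes π))) ≡⟨ insert-least _ (++⁺ (replicate⁺ (N₁ π) ≤-refl) (map⁺ (universal (λ _ → s≤s z≤n) _))) ⟩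
  1 ∷ replicate (N₁ π) 1 ++ map suc (sort (stripOnes π))        ∎
sort-stripOnes (suc (suc x) ∷ π) (_ ∷ π⁺) = begin
  insert (2 + x) (sort π)                                             ≡⟨ cong (insert (2 + x)) (sort-stripOnes π π⁺) ⟩
  insert (2 + x) (replicate (N₁ π) 1 ++ map suc (sort (stripOnes π))) ≡⟨ insert-++ (replicate (N₁ π) 1) _ (replicate⁺ (N₁ π) (s≤s (s≤s z≤n))) ⟩
  replicate (N₁ π) 1 ++ insert (2 + x) (map suc (sort (stripOnes π))) ≡⟨ cong (replicate (N₁ π) 1 ++_) (insert-map-suc (suc x) (sort (stripOnes π))) ⟩
  replicate (N₁ π) 1 ++ map suc (insert (suc x) (sort (stripOnes π))) ∎

stripOnes-positive : ∀ {π} → All (1 ≤_) π → All (1 ≤_) (stripOnes π)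
stripOnes-positive                    []       = []
stripOnes-positive {suc zero ∷ _}     (_ ∷ π⁺) = stripOnes-positive π⁺
stripOnes-positive {suc (suc _) ∷ _}  (_ ∷ π⁺) = s≤s z≤n ∷ stripOnes-positive π⁺

All-sort : ∀ {P : ℕ → Set} {π} → All P π → All P (sort π)
All-sort {π = π} = All-resp-↭ (↭-sym (sort-↭ π))

okFrom-ones : ∀ b k M → okFrom (suc b) (replicate k 1 ++ M) ≡ okFrom (suc (b + k)) M
okFrom-ones b zero    M = cong (λ c → okFrom (suc c) M) (sym (+-identityʳ b))
okFrom-ones b (suc k) M = trans (okFrom-ones (suc b) k M) (cong (λ c → okFrom (suc c) M) (sym (+-suc b k)))

okFrom-map-suc : ∀ c S → All (1 ≤_) S → okFrom (suc c) (map suc S) ≡ okFrom c S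
okFrom-map-suc c []          []      = refl
okFrom-map-suc c (suc x ∷ S) (_ ∷ S⁺) = cong (_ ∧_) (okFrom-map-suc (suc c) S S⁺)

isPFFrom-stripOnes : ∀ a π → All (1 ≤_) π → isPFFrom (suc a) π ≡ isPFFrom (a + N₁ π) (stripOnes π)
isPFFrom-stripOnes a π π⁺ = begin
  okFrom (suc a) (sort π)                                             ≡⟨ cong (okFrom (suc a)) (sort-stripOnes π π⁺) ⟩
  okFrom (suc a) (replicate (N₁ π) 1 ++ map suc (sort (stripOnes π))) ≡⟨ okFrom-ones a (N₁ π) _ ⟩
  okFrom (suc (a + N₁ π)) (map suc (sort (stripOnes π)))              ≡⟨ okFrom-map-suc (a + N₁ π) _ (All-sort (stripOnes-positive π⁺)) ⟩
  okFrom (a + N₁ π) (sort (stripOnes π))                              ∎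

isPFFrom-zero : ∀ x π → isPFFrom 0 (x ∷ π) ≡ false
isPFFrom-zero x π = okFrom-zero (sort (x ∷ π)) (↭-length (sort-↭ (x ∷ π)))
  where
  okFrom-zero : ∀ L → length L ≡ suc (length π) → okFrom 0 L ≡ false
  okFrom-zero (zero  ∷ _) _ = refl
  okFrom-zero (suc _ ∷ _) _ = refl

okFrom-suc : ∀ {b} L → T (okFrom b L) → T (okFrom (suc b) L)
okFrom-suc         []          _  = _
okFrom-suc {b} (suc x ∷ L) ok with Equivalence.to (T-∧ {suc x ≤ᵇ b}) ok
... | x≤b , okL = Equivalence.from T-∧ (≤⇒≤ᵇ (m≤n⇒m≤1+n (≤ᵇ⇒≤ (suc x) b x≤b)) , okFrom-suc L okL)

okFrom-bounded : ∀ {b} L → T (okFrom b L) → All (_< length L + b) L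
okFrom-bounded         []          _  = []
okFrom-bounded {b} (suc x ∷ L) ok with Equivalence.to (T-∧ {suc x ≤ᵇ b}) ok
... | x≤b , okL = s≤s (≤-trans (≤ᵇ⇒≤ (suc x) b x≤b) (m≤n+m b (length L)))
                ∷ subst (λ c → All (_< c) L) (+-suc (length L) b) (okFrom-bounded L okL)

isPFFrom-bounded : ∀ b π → T (isPFFrom b π) → All (_< length π + b) π
isPFFrom-bounded b π ok =
  All-resp-↭ (sort-↭ π) (subst (λ l → All (_< l + b) (sort π)) (↭-length (sort-↭ π)) (okFrom-bounded (sort π) ok))

count-by-ones : ∀ n m (Q : ℕ → List ℕ → Bool) →
  count (λ π → Q (N₁ π) (stripOnes π)) (seqs (suc m) n) ≡ ∑[ k < suc n ] ((n C k) * count (Q k) (seqs m (n ∸ k)))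
count-by-ones zero    m Q = sym (trans (+-identityʳ _) (*-identityˡ _))
count-by-ones (suc n) m Q = begin
  count (λ π → Q (N₁ π) (stripOnes π)) (seqs (suc m) (suc n))
    ≡⟨ count-seqs-suc (λ π → Q (N₁ π) (stripOnes π)) (suc m) n ⟩
  count (λ ρ → Q (suc (N₁ ρ)) (stripOnes ρ)) (seqs (suc m) n)
    + ∑[ w < m ] count (λ ρ → Q (N₁ ρ) (suc w ∷ stripOnes ρ)) (seqs (suc m) n)
    ≡⟨ cong₂ _+_ (count-by-ones n m (λ k → Q (suc k))) (∑-cong m λ {w} _ → count-by-ones n m (λ k ρ → Q k (suc w ∷ ρ))) ⟩
  S₁ + ∑[ w < m ] ∑[ k < suc n ] ((n C k) * count (λ ρ → Q k (suc w ∷ ρ)) (seqs m (n ∸ k)))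
    ≡⟨ cong (S₁ +_) (∑-comm m (suc n) (λ w k → (n C k) * count (λ ρ → Q k (suc w ∷ ρ)) (seqs m (n ∸ k)))) ⟩
  S₁ + ∑[ k < suc n ] ∑[ w < m ] ((n C k) * count (λ ρ → Q k (suc w ∷ ρ)) (seqs m (n ∸ k)))
    ≡⟨ cong (S₁ +_) (∑-cong (suc n) λ {k} _ → trans (sym (*-distribˡ-∑ m (n C k) (λ w → count (λ ρ → Q k (suc w ∷ ρ)) (seqs m (n ∸ k)))))
                                                     (cong ((n C k) *_) (sym (count-seqs-suc (Q k) m (n ∸ k))))) ⟩
  S₁ + ∑[ k < suc n ] ((n C k) * count (Q k) (seqs m (suc (n ∸ k))))
    ≡⟨ ∑-pascal n (λ k l → count (Q k) (seqs m l)) ⟨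
  ∑[ k < suc (suc n) ] ((suc n C k) * count (Q k) (seqs m (suc n ∸ k))) ∎
  where
  S₁ = ∑[ k < suc n ] ((n C k) * count (Q (suc k)) (seqs m (n ∸ k)))

count-by-ones-≡ : ∀ n m k (Q : ℕ → List ℕ → Bool) → k ≤ n →
  count (λ π → Q (N₁ π) (stripOnes π) ∧ (N₁ π ≡ᵇ k)) (seqs (suc m) n) ≡ (n C k) * count (Q k) (seqs m (n ∸ k))
count-by-ones-≡ n m k Q k≤n = begin
  count (λ π → Q (N₁ π) (stripOnes π) ∧ (N₁ π ≡ᵇ k)) (seqs (suc m) n)
    ≡⟨ count-by-ones n m (λ i ρ → Q i ρ ∧ (i ≡ᵇ k)) ⟩
  ∑[ i < suc n ] ((n C i) * count (λ ρ → Q i ρ ∧ (i ≡ᵇ k)) (seqs m (n ∸ i)))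
    ≡⟨ ∑-single k (s≤s k≤n) (λ {i} _ i≢k → trans (cong ((n C i) *_) (count-zero (seqs m (n ∸ i)) (λ ρ → trans (cong (Q i ρ ∧_) (dec-false (i ≟ k) i≢k)) (∧-zeroʳ _)))) (*-zeroʳ (n C i))) ⟩
  (n C k) * count (λ ρ → Q k ρ ∧ (k ≡ᵇ k)) (seqs m (n ∸ k))
    ≡⟨ cong ((n C k) *_) (count-cong (seqs m (n ∸ k)) (λ ρ → trans (cong (Q k ρ ∧_) (dec-true (k ≟ k) refl)) (∧-identityʳ _))) ⟩
  (n C k) * count (Q k) (seqs m (n ∸ k)) ∎

count-isPFFrom : ∀ m b n → b + n ≤ suc m → count (isPFFrom b) (seqs m n) ≡ numPFFrom b n
count-isPFFrom m       b       zero    _ = refl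
count-isPFFrom m       zero    (suc n) _ = trans (count-seqs-suc (isPFFrom 0) m n)
  (∑-zero m λ {w} _ → count-zero (seqs m n) (isPFFrom-zero (suc w)))
count-isPFFrom zero    (suc a) (suc n) (s≤s a+n<0) with () ← subst (_≤ 0) (+-suc a n) a+n<0
count-isPFFrom (suc m) (suc a) n       a+n≤m = begin
  count (isPFFrom (suc a)) (seqs (suc m) n)
    ≡⟨ count-cong-seqs (suc m) n (λ {π} _ π⁺ → isPFFrom-stripOnes a π π⁺) ⟩
  count (λ π → isPFFrom (a + N₁ π) (stripOnes π)) (seqs (suc m) n)
    ≡⟨ count-by-ones n m (λ k → isPFFrom (a + k)) ⟩
  ∑[ k < suc n ] ((n C k) * count (isPFFrom (a + k)) (seqs m (n ∸ k)))
    ≡⟨ ∑-cong (suc n) (λ {k} k<1+n → cong ((n C k) *_) (count-isPFFrom m (a + k) (n ∸ k) (bound (≤-pred k<1+n)))) ⟩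
  ∑[ k < suc n ] ((n C k) * numPFFrom (a + k) (n ∸ k))
    ≡⟨ ∑-abel a n ⟩
  numPFFrom (suc a) n ∎
  where
  bound : ∀ {k} → k ≤ n → a + k + (n ∸ k) ≤ suc m
  bound {k} k≤n rewrite +-assoc a k (n ∸ k) | m+[n∸m]≡n k≤n = ≤-pred a+n≤m

-- Prime parking functions

length-removeOnes : ∀ π → length (removeOnes π) ≡ N₁ π
length-removeOnes []                = refl
length-removeOnes (zero ∷ π)        = trans (length-map (zero ∷_) (removeOnes π)) (length-removeOnes π)
length-removeOnes (suc zero ∷ π)    = cong suc (trans (length-map (1 ∷_) (removeOnes π)) (length-removeOnes π))
length-removeOnes (suc (suc x) ∷ π) = trans (length-map (suc (suc x) ∷_) (removeOnes π)) (length-removeOnes π)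

removeOnes-stripOnes : ∀ {π} → All (1 ≤_) π →
  All (λ ρ → All (1 ≤_) ρ × suc (N₁ ρ) ≡ N₁ π × stripOnes ρ ≡ stripOnes π) (removeOnes π)
removeOnes-stripOnes                    []       = []
removeOnes-stripOnes {suc zero ∷ _}     (_ ∷ π⁺) = (π⁺ , refl , refl) ∷
  map⁺ (All.map (λ { (ρ⁺ , N₁≡ , strip≡) → (s≤s z≤n ∷ ρ⁺) , cong suc N₁≡ , strip≡ }) (removeOnes-stripOnes π⁺))
removeOnes-stripOnes {suc (suc x) ∷ _}  (_ ∷ π⁺) =
  map⁺ (All.map (λ { (ρ⁺ , N₁≡ , strip≡) → (s≤s z≤n ∷ ρ⁺) , N₁≡ , cong (suc x ∷_) strip≡ }) (removeOnes-stripOnes π⁺))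

allB-const : ∀ {A : Set} {p : A → Bool} {c} xs → All (λ x → p x ≡ c) xs → allB p xs ≡ (length xs ≡ᵇ 0) ∨ c
allB-const             []       []          = refl
allB-const {c = c} (x ∷ xs) (px≡c ∷ pxs≡c) rewrite px≡c | allB-const xs pxs≡c = absorb c
  where
  absorb : ∀ c → c ∧ ((length xs ≡ᵇ 0) ∨ c) ≡ c
  absorb false = refl
  absorb true  = ∨-zeroʳ _

okFrom-∧-pred : ∀ N L → okFrom N L ∧ ((N ≡ᵇ 0) ∨ okFrom (N ∸ 1) L) ≡ okFrom (N ∸ 1) L
okFrom-∧-pred zero    L = ∧-identityʳ _
okFrom-∧-pred (suc N) L with okFrom N L in ok
... | false = ∧-zeroʳ _
... | true  = trans (∧-identityʳ _) (Equivalence.to T-≡ (okFrom-suc L (Equivalence.from T-≡ ok)))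

isPPF-stripOnes : ∀ π → All (1 ≤_) π → isPPF π ≡ isPFFrom (N₁ π ∸ 1) (stripOnes π)
isPPF-stripOnes π π⁺ = begin
  isPF π ∧ allB isPF (removeOnes π)
    ≡⟨ cong₂ _∧_ (isPFFrom-stripOnes 0 π π⁺) (allB-const (removeOnes π) (All.map isPF-removed (removeOnes-stripOnes π⁺))) ⟩
  isPFFrom (N₁ π) S ∧ ((length (removeOnes π) ≡ᵇ 0) ∨ isPFFrom (N₁ π ∸ 1) S)
    ≡⟨ cong (λ l → isPFFrom (N₁ π) S ∧ ((l ≡ᵇ 0) ∨ isPFFrom (N₁ π ∸ 1) S)) (length-removeOnes π) ⟩
  isPFFrom (N₁ π) S ∧ ((N₁ π ≡ᵇ 0) ∨ isPFFrom (N₁ π ∸ 1) S)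
    ≡⟨ okFrom-∧-pred (N₁ π) (sort S) ⟩
  isPFFrom (N₁ π ∸ 1) S ∎
  where
  S = stripOnes π
  isPF-removed : ∀ {ρ} → All (1 ≤_) ρ × suc (N₁ ρ) ≡ N₁ π × stripOnes ρ ≡ S → isPF ρ ≡ isPFFrom (N₁ π ∸ 1) S
  isPF-removed {ρ} (ρ⁺ , N₁≡ , strip≡) =
    trans (isPFFrom-stripOnes 0 ρ ρ⁺) (cong₂ isPFFrom (cong (_∸ 1) N₁≡) strip≡)

toℚᵘ-ℕ→ℚ : ∀ a → ℚ.toℚᵘ (ℕ→ℚ a) ℚᵘ.≃ ℚᵘ.mkℚᵘ (ℤ.+ a) 0
toℚᵘ-ℕ→ℚ a = ℚ.toℚᵘ-fromℚᵘ (ℚᵘ.mkℚᵘ (ℤ.+ a) 0)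

ℕ→ℚ-+ : ∀ a b → ℕ→ℚ (a + b) ≡ ℕ→ℚ a ℚ.+ ℕ→ℚ b
ℕ→ℚ-+ a b = ℚ.toℚᵘ-injective (begin≃
  ℚ.toℚᵘ (ℕ→ℚ (a + b))                        ≈⟨ toℚᵘ-ℕ→ℚ (a + b) ⟩
  ℚᵘ.mkℚᵘ (ℤ.+ (a + b)) 0                        ≈⟨ ℚᵘ.*≡* cross-multiplied ⟩
  ℚᵘ.mkℚᵘ (ℤ.+ a) 0 ℚᵘ.+ ℚᵘ.mkℚᵘ (ℤ.+ b) 0         ≈⟨ ℚᵘ.+-cong (toℚᵘ-ℕ→ℚ a) (toℚᵘ-ℕ→ℚ b) ⟨
  ℚ.toℚᵘ (ℕ→ℚ a) ℚᵘ.+ ℚ.toℚᵘ (ℕ→ℚ b)           ≈⟨ ℚ.toℚᵘ-homo-+ (ℕ→ℚ a) (ℕ→ℚ b) ⟨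
  ℚ.toℚᵘ (ℕ→ℚ a ℚ.+ ℕ→ℚ b)                     ∎≃)
  where
  open ℚᵘ.≃-Reasoning using (step-≈-⟩; step-≈-⟨) renaming (begin_ to begin≃_; _∎ to _∎≃)
  cross-multiplied : (ℤ.+ (a + b)) ℤ.* ℤ.1ℤ ≡ ((ℤ.+ a) ℤ.* ℤ.1ℤ ℤ.+ (ℤ.+ b) ℤ.* ℤ.1ℤ) ℤ.* ℤ.1ℤ
  cross-multiplied = cong (ℤ._* ℤ.1ℤ) (trans (ℤ.pos-+ a b) (sym (cong₂ ℤ._+_ (ℤ.*-identityʳ (ℤ.+ a)) (ℤ.*-identityʳ (ℤ.+ b)))))

ℕ→ℚ-scale : ∀ n d x y → n * x ≡ suc d * y → (ℤ.+ n ℚ./ suc d) ℚ.* ℕ→ℚ x ≡ ℕ→ℚ y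
ℕ→ℚ-scale n d x y n*x≡ = ℚ.toℚᵘ-injective (begin≃
  ℚ.toℚᵘ ((ℤ.+ n ℚ./ suc d) ℚ.* ℕ→ℚ x)                 ≈⟨ ℚ.toℚᵘ-homo-* (ℤ.+ n ℚ./ suc d) (ℕ→ℚ x) ⟩
  ℚ.toℚᵘ (ℤ.+ n ℚ./ suc d) ℚᵘ.* ℚ.toℚᵘ (ℕ→ℚ x)         ≈⟨ ℚᵘ.*-cong (ℚ.toℚᵘ-fromℚᵘ (ℚᵘ.mkℚᵘ (ℤ.+ n) d)) (toℚᵘ-ℕ→ℚ x) ⟩
  ℚᵘ.mkℚᵘ (ℤ.+ n) d ℚᵘ.* ℚᵘ.mkℚᵘ (ℤ.+ x) 0               ≈⟨ ℚᵘ.*≡* cross-multiplied ⟩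
  ℚᵘ.mkℚᵘ (ℤ.+ y) 0                                     ≈⟨ toℚᵘ-ℕ→ℚ y ⟨
  ℚ.toℚᵘ (ℕ→ℚ y)                                      ∎≃)
  where
  open ℚᵘ.≃-Reasoning using (step-≈-⟩; step-≈-⟨) renaming (begin_ to begin≃_; _∎ to _∎≃)
  cross-multiplied : ((ℤ.+ n) ℤ.* (ℤ.+ x)) ℤ.* ℤ.1ℤ ≡ (ℤ.+ y) ℤ.* (ℤ.+ (suc d * 1))
  cross-multiplied = begin
    ((ℤ.+ n) ℤ.* (ℤ.+ x)) ℤ.* ℤ.1ℤ   ≡⟨ ℤ.*-identityʳ ((ℤ.+ n) ℤ.* (ℤ.+ x)) ⟩
    (ℤ.+ n) ℤ.* (ℤ.+ x)             ≡⟨ ℤ.pos-* n x ⟨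
    ℤ.+ (n * x)                     ≡⟨ cong ℤ.+_ (trans n*x≡ (trans (*-comm (suc d) y) (cong (y *_) (sym (*-identityʳ (suc d)))))) ⟩
    ℤ.+ (y * (suc d * 1))           ≡⟨ ℤ.pos-* y (suc d * 1) ⟩
    (ℤ.+ y) ℤ.* (ℤ.+ (suc d * 1))   ∎

foldr-+-applyUpTo : ∀ m (h : ℕ → ℚ.ℚ) (g : ℕ → ℕ) → (∀ {i} → i < m → h i ≡ ℕ→ℚ (g i)) →
  foldr ℚ._+_ ℚ.0ℚ (applyUpTo h m) ≡ ℕ→ℚ (∑< m g)
foldr-+-applyUpTo zero    h g eq = refl
foldr-+-applyUpTo (suc m) h g eq =
  trans (cong₂ ℚ._+_ (eq (s≤s z≤n)) (foldr-+-applyUpTo m (λ i → h (suc i)) (λ i → g (suc i)) (λ i<m → eq (s≤s i<m))))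
        (sym (ℕ→ℚ-+ (g 0) (∑[ i < m ] g (suc i))))

numPPFfirst≡count : ∀ n j → 1 ≤ j → j ≤ suc n → numPPFfirst n j ≡ count (λ σ → isPPF (j ∷ σ)) (seqs (suc n) n)
numPPFfirst≡count n j 1≤j j≤1+n = begin
  countB (λ π → isPPF π ∧ firstIs j π) (seqs (suc n) (suc n))
    ≡⟨ countB≡count _ (seqs (suc n) (suc n)) ⟩
  count (λ π → isPPF π ∧ firstIs j π) (seqs (suc n) (suc n))
    ≡⟨ count-cong (seqs (suc n) (suc n)) (λ π → ∧-comm (isPPF π) (firstIs j π)) ⟩
  count (λ π → firstIs j π ∧ isPPF π) (seqs (suc n) (suc n))
    ≡⟨ count-seqs-firstIs {l = n} isPPF 1≤j j≤1+n ⟩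
  count (λ σ → isPPF (j ∷ σ)) (seqs (suc n) n) ∎

numPF≡numPFFrom1 : ∀ n → numPF n ≡ numPFFrom 1 n
numPF≡numPFFrom1 n = trans (countB≡count isPF (seqs n n)) (count-isPFFrom n 1 n ≤-refl)

numPPFfirst-1 : ∀ n → numPPFfirst n 1 ≡ numPF n
numPPFfirst-1 n = begin
  numPPFfirst n 1                         ≡⟨ numPPFfirst≡count n 1 (s≤s z≤n) (s≤s z≤n) ⟩
  count (λ σ → isPPF (1 ∷ σ)) (seqs (suc n) n) ≡⟨ count-cong-seqs (suc n) n (λ {σ} _ σ⁺ → isPPF-1∷ σ σ⁺) ⟩
  count isPF (seqs (suc n) n)             ≡⟨ count-isPFFrom (suc n) 1 n (m≤n⇒m≤1+n ≤-refl) ⟩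
  numPFFrom 1 n                           ≡⟨ numPF≡numPFFrom1 n ⟨
  numPF n                                 ∎
  where
  isPPF-1∷ : ∀ σ → All (1 ≤_) σ → isPPF (1 ∷ σ) ≡ isPF σ
  isPPF-1∷ σ σ⁺ = trans (isPPF-stripOnes (1 ∷ σ) (s≤s z≤n ∷ σ⁺)) (sym (isPFFrom-stripOnes 0 σ σ⁺))

numPF-suc : ∀ n → numPF (suc n) ≡ suc (suc n) ^ n
numPF-suc n = trans (numPF≡numPFFrom1 (suc n)) (*-identityˡ _)

numPPFfirst-≥2 : ∀ n j′ → 2 + j′ ≤ suc n →
  numPPFfirst (suc n) (2 + j′) ≡ ∑[ i < n ] ((suc n C (2 + i)) * count (λ ρ → isPFFrom (suc i) (suc j′ ∷ ρ)) (seqs n (n ∸ suc i)))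
numPPFfirst-≥2 n j′ j≤1+n = begin
  numPPFfirst (suc n) (2 + j′)
    ≡⟨ numPPFfirst≡count (suc n) (2 + j′) (s≤s z≤n) (m≤n⇒m≤1+n j≤1+n) ⟩
  count (λ σ → isPPF (2 + j′ ∷ σ)) (seqs (2 + n) (suc n))
    ≡⟨ count-cong-seqs (2 + n) (suc n) (λ {σ} _ σ⁺ → isPPF-stripOnes (2 + j′ ∷ σ) (s≤s z≤n ∷ σ⁺)) ⟩
  count (λ σ → isPFFrom (N₁ σ ∸ 1) (suc j′ ∷ stripOnes σ)) (seqs (2 + n) (suc n))
    ≡⟨ count-by-ones (suc n) (suc n) (λ k ρ → isPFFrom (k ∸ 1) (suc j′ ∷ ρ)) ⟩
  ∑[ k < 2 + n ] ((suc n C k) * count (λ ρ → isPFFrom (k ∸ 1) (suc j′ ∷ ρ)) (seqs (suc n) (suc n ∸ k)))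
    ≡⟨ cong₂ (λ a b → a + (b + ∑[ i < n ] A (suc n) i)) (cong (1 *_) (none (suc n))) (trans (cong ((suc n C 1) *_) (none n)) (*-zeroʳ (suc n C 1))) ⟩
  ∑[ i < n ] A (suc n) i
    ≡⟨ ∑-cong n (λ {i} i<n → cong ((suc n C (2 + i)) *_) (count-seqs-shrink n (n ∸ suc i) _ (bounded i<n))) ⟩
  ∑[ i < n ] A n i ∎
  where
  A : ℕ → ℕ → ℕ
  A m i = (suc n C (2 + i)) * count (λ ρ → isPFFrom (suc i) (suc j′ ∷ ρ)) (seqs m (n ∸ suc i))
  none : ∀ l → count (λ ρ → isPFFrom 0 (suc j′ ∷ ρ)) (seqs (suc n) l) ≡ 0
  none l = count-zero (seqs (suc n) l) (isPFFrom-zero (suc j′))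
  bounded : ∀ {i} → i < n → ∀ {ρ} → length ρ ≡ n ∸ suc i → T (isPFFrom (suc i) (suc j′ ∷ ρ)) → All (_≤ n) ρ
  bounded {i} i<n {ρ} len ok with isPFFrom-bounded (suc i) (suc j′ ∷ ρ) ok
  ... | _ ∷ ρ<1+n = All.map (λ {y} y< → ≤-pred (subst (y <_) length≡ y<)) ρ<1+n
    where
    length≡ : suc (length ρ) + suc i ≡ suc n
    length≡ = cong suc (trans (cong (_+ suc i) len) (m∸n+n≡m i<n))

f-≥2 : ∀ n j′ k → 2 + j′ ≤ suc n → k ≤ n →
  f (suc n) (2 + j′) k ≡ (n C k) * count (λ ρ → isPFFrom k (suc j′ ∷ ρ)) (seqs n (n ∸ k))
f-≥2 n j′ k j≤1+n k≤n = begin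
  countB (λ π → isPF π ∧ firstIs j π ∧ (N₁ π ≡ᵇ k)) (seqs (suc n) (suc n))
    ≡⟨ countB≡count _ (seqs (suc n) (suc n)) ⟩
  count (λ π → isPF π ∧ firstIs j π ∧ (N₁ π ≡ᵇ k)) (seqs (suc n) (suc n))
    ≡⟨ count-cong (seqs (suc n) (suc n)) (λ π → ∧-left-comm (isPF π) (firstIs j π) (N₁ π ≡ᵇ k)) ⟩
  count (λ π → firstIs j π ∧ (isPF π ∧ (N₁ π ≡ᵇ k))) (seqs (suc n) (suc n))
    ≡⟨ count-seqs-firstIs {l = n} (λ π → isPF π ∧ (N₁ π ≡ᵇ k)) (s≤s z≤n) j≤1+n ⟩
  count (λ τ → isPF (j ∷ τ) ∧ (N₁ τ ≡ᵇ k)) (seqs (suc n) n)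
    ≡⟨ count-cong-seqs (suc n) n (λ {τ} _ τ⁺ → cong (_∧ (N₁ τ ≡ᵇ k)) (isPFFrom-stripOnes 0 (j ∷ τ) (s≤s z≤n ∷ τ⁺))) ⟩
  count (λ τ → isPFFrom (N₁ τ) (suc j′ ∷ stripOnes τ) ∧ (N₁ τ ≡ᵇ k)) (seqs (suc n) n)
    ≡⟨ count-by-ones-≡ n n k (λ i ρ → isPFFrom i (suc j′ ∷ ρ)) k≤n ⟩
  (n C k) * count (λ ρ → isPFFrom k (suc j′ ∷ ρ)) (seqs n (n ∸ k)) ∎
  where
  j = 2 + j′

ℕ→ℚ-numPPFfirst-≥2 : ∀ n j′ → 2 + j′ ≤ suc n → ℕ→ℚ (numPPFfirst (suc n) (2 + j′)) ≡ rhsSum (suc n) (2 + j′)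
ℕ→ℚ-numPPFfirst-≥2 n j′ j≤1+n = begin
  ℕ→ℚ (numPPFfirst (suc n) (2 + j′))                    ≡⟨ cong ℕ→ℚ (numPPFfirst-≥2 n j′ j≤1+n) ⟩
  ℕ→ℚ (∑[ i < n ] ((suc n C (2 + i)) * A i))            ≡⟨ foldr-+-applyUpTo n (λ i → t (suc i)) (λ i → (suc n C (2 + i)) * A i) term ⟨
  foldr ℚ._+_ ℚ.0ℚ (applyUpTo (λ i → t (suc i)) n)     ≡⟨ cong (foldr ℚ._+_ ℚ.0ℚ) (trans (cong (map t) (map-upTo suc n)) (map-applyUpTo suc t n)) ⟨
  rhsSum (suc n) (2 + j′)                               ∎
  where
  t : ℕ → ℚ.ℚ
  t k = (ℤ.+ suc n ℚ./ suc k) ℚ.* ℕ→ℚ (f (suc n) (2 + j′) k)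
  A : ℕ → ℕ
  A i = count (λ ρ → isPFFrom (suc i) (suc j′ ∷ ρ)) (seqs n (n ∸ suc i))
  term : ∀ {i} → i < n → t (suc i) ≡ ℕ→ℚ ((suc n C (2 + i)) * A i)
  term {i} i<n = begin
    (ℤ.+ suc n ℚ./ (2 + i)) ℚ.* ℕ→ℚ (f (suc n) (2 + j′) (suc i))  ≡⟨ cong (λ z → (ℤ.+ suc n ℚ./ (2 + i)) ℚ.* ℕ→ℚ z) (f-≥2 n j′ (suc i) j≤1+n i<n) ⟩
    (ℤ.+ suc n ℚ./ (2 + i)) ℚ.* ℕ→ℚ ((n C suc i) * A i)          ≡⟨ ℕ→ℚ-scale (suc n) (suc i) ((n C suc i) * A i) ((suc n C (2 + i)) * A i) absorbed ⟩
    ℕ→ℚ ((suc n C (2 + i)) * A i)                              ∎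
    where
    absorbed : suc n * ((n C suc i) * A i) ≡ (2 + i) * ((suc n C (2 + i)) * A i)
    absorbed = begin
      suc n * ((n C suc i) * A i)          ≡⟨ *-assoc (suc n) (n C suc i) (A i) ⟨
      suc n * (n C suc i) * A i            ≡⟨ cong (_* A i) ([k+1]*[n+1]C[k+1]≡[n+1]*nCk n (suc i)) ⟨
      (2 + i) * (suc n C (2 + i)) * A i    ≡⟨ *-assoc (2 + i) (suc n C (2 + i)) (A i) ⟩
      (2 + i) * ((suc n C (2 + i)) * A i)  ∎

theorem2p2 : (n : ℕ) → 1 ≤ n →
    ((numPPFfirst n 1 ≡ numPF n) × (numPF n ≡ suc n ^ (n ∸ 1)))
    × ((j : ℕ) → 2 ≤ j → j ≤ n → ℕ→ℚ (numPPFfirst n j) ≡ rhsSum n j)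
theorem2p2 (suc n) _ =
  (numPPFfirst-1 (suc n) , numPF-suc n) ,
  λ { (suc (suc j′)) (s≤s (s≤s z≤n)) j≤1+n → ℕ→ℚ-numPPFfirst-≥2 n j′ j≤1+n }
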